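{- For all natural numbers $n \geq 1$ and $m \geq 3$, $\gamma_b(S^n_m) = n + \left\lfloor \frac{m}{2} \right\rfloor$.
   Context: For integers $m \geq 3$ and $n \geq 1$, the $m$-sunlet graph of degree $n$, denoted $S^n_m$, is obtained from the cycle $C_m$ (whose vertices are called base vertices) by attaching to each base vertex $b$ a path of $n$ new vertices $b = u_0, u_1, \dots, u_n$ (edges $u_0u_1,\dots,u_{n-1}u_n$), distinct for different base vertices; so the leaf $u_n$ of each branch is at distance $n$ from its base vertex. For a finite graph $G$ with shortest-path distance $d$, a dominating broadcast function is a function $f: V(G) \to \{0,1,2,\dots\}$ such that every vertex $u$ of $G$ satisfies $d(u,v) \leq f(v)$ for at least one vertex $v$ with $f(v) \geq 1$. The cost of $f$ is $\sum_{v \in V(G)} f(v)$, and $\gamma_b(G)$ is the minimum cost of a dominating broadcast function of $G$. -}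

module Defs where

open import Data.Nat using (ℕ; zero; suc; _+_; _∸_; _≤_)
open import Data.Fin using (Fin; toℕ) renaming (zero to fzero; suc to fsuc)
open import Data.Fin.Base using (inject₁)
open import Data.Product using (_×_; _,_; Σ; ∃; ∃-syntax)
open import Data.List using (List; map; allFin)
open import Data.Nat.ListAction using (sum)
open import Relation.Binary.PropositionalEquality using (_≡_)

-- Vertices of the m-sunlet graph of degree n, S^n_m:
-- (i , k) is the vertex at depth k on the branch attached to base vertex i
-- of the cycle C_m; (i , 0) is the base vertex itself, (i , n) its leaf.
Vertex : ℕ → ℕ → Set
Vertex m n = Fin m × Fin (suc n)

data CycleStep (m : ℕ) : Fin m → Fin m → Set where
  next : (i j : Fin m) → toℕ j ≡ suc (toℕ i) → CycleStep m i j
  wrap : (i j : Fin m) → toℕ i ≡ m ∸ 1 → toℕ j ≡ 0 → CycleStep m i j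

data Adj (m n : ℕ) : Vertex m n → Vertex m n → Set where
  cyc     : ∀ {i j} → CycleStep m i j → Adj m n (i , fzero) (j , fzero)
  cyc⁻¹   : ∀ {i j} → CycleStep m i j → Adj m n (j , fzero) (i , fzero)
  down    : ∀ i (k : Fin n) → Adj m n (i , inject₁ k) (i , fsuc k)
  up      : ∀ i (k : Fin n) → Adj m n (i , fsuc k) (i , inject₁ k)

data Walk (m n : ℕ) : Vertex m n → Vertex m n → ℕ → Set where
  here : ∀ u → Walk m n u u 0
  step : ∀ {u v w l} → Adj m n u v → Walk m n v w l → Walk m n u w (suc l)

DistLe : (m n : ℕ) → Vertex m n → Vertex m n → ℕ → Set
DistLe m n u v k = Σ ℕ λ l → l ≤ k × Walk m n u v l

Dominating : (m n : ℕ) → (Vertex m n → ℕ) → Set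
Dominating m n f = ∀ u → ∃[ v ] (1 ≤ f v × DistLe m n u v (f v))

cost : (m n : ℕ) → (Vertex m n → ℕ) → ℕ
cost m n f = sum (map (λ i → sum (map (λ k → f (i , k)) (allFin (suc n)))) (allFin m))

BroadcastDomNumber : (m n c : ℕ) → Set
BroadcastDomNumber m n c =
  (Σ (Vertex m n → ℕ) λ f → Dominating m n f × cost m n f ≡ c)
  × (∀ f → Dominating m n f → c ≤ cost m n f)

-- Broadcasting n + ⌊m/2⌋ from a single base vertex reaches every vertex of S^n_m.
-- Conversely, let f be a dominating broadcast and E its largest excess f(v) ∸ depth(v).
-- If E ≥ n, count leaves: a vertex of depth k and power F reaches the leaves of at most
-- 2(F ∸ (n + k)) + 1 ≤ 2F branches, and a vertex of excess E saves a further 2n, so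
-- m + 2n ≤ 2·cost + 1.  If E < n, no vertex reaches the levels E, …, n of another
-- branch (that needs power at least depth + E + 1); on its own branch a vertex of power F
-- reaches at most 2F + 1 ≤ 3F of these levels, and a vertex of excess E > 0 at depth k
-- reaches at most 2k + 1 of them, so m(n ∸ E + 1) + 3E ≤ 3·cost + 1.  Either inequality
-- forces cost ≥ n + ⌊m/2⌋.  Distances are bounded below by 1-Lipschitz potentials along
-- walks: the depth, and the distance from a fixed leaf.
module Submission where

open import Defs
open import Data.Nat
  using (ℕ; zero; suc; _+_; _*_; _∸_; _≤_; _<_; z≤n; s≤s; s≤s⁻¹; _≤?_; _⊓_; ∣_-_∣; _/_; _%_; NonZero)
open import Data.Nat.Properties
open import Data.Nat.DivMod using ([m+n]%n≡m%n; m<n⇒m%n≡m; m≡m%n+[m/n]*n; m%n<n; m/n*n≤m)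
import Data.Nat.ListAction as List
open import Data.Nat.Tactic.RingSolver using (solve-∀)
open import Data.Fin as Fin
  using (Fin; toℕ; inject₁; fromℕ; fromℕ<; punchIn) renaming (zero to fzero; suc to fsuc)
open import Data.Fin.Properties using (toℕ<n; toℕ-fromℕ; toℕ-fromℕ<; toℕ-inject₁; toℕ-injective)
open import Data.Product using (_×_; _,_; ∃-syntax; proj₁; proj₂)
open import Data.Sum using (inj₁; inj₂)
open import Data.List using (map; tabulate)
open import Data.Vec.Functional using (removeAt)
open import Function using (_∘_; id)
open import Algebra.Properties.Semiring.Sum +-*-semiring
  using (sum; sum-syntax; sum-cong-≗; ∑-comm; sum-remove; sum-replicate-zero; *-distribˡ-sum)
open import Algebra.Properties.CommutativeSemigroup +-commutativeSemigroup using (xy∙z≈xz∙y)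
open import Relation.Binary.PropositionalEquality
open import Relation.Nullary using (Dec; yes; no; _×-dec_)
open import Relation.Nullary.Negation using (contradiction)

private variable
  N K : ℕ
  P Q : Set

-- Finite sums and counting

∑-mono-≤ : {f g : Fin N → ℕ} → (∀ i → f i ≤ g i) → ∑[ i < N ] f i ≤ ∑[ i < N ] g i
∑-mono-≤ {zero}  f≤g = z≤n
∑-mono-≤ {suc N} f≤g = +-mono-≤ (f≤g fzero) (∑-mono-≤ (f≤g ∘ fsuc))

∑-mono-≤-at : {f g : Fin N → ℕ} (c c' : ℕ) → (∀ i → f i ≤ g i) → (i₀ : Fin N) →
              f i₀ + c ≤ g i₀ + c' → ∑[ i < N ] f i + c ≤ ∑[ i < N ] g i + c'
∑-mono-≤-at {suc N} {f} {g} c c' f≤g i₀ at = begin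
  sum f + c                        ≡⟨ cong (_+ c) (sum-remove {i = i₀} f) ⟩
  f i₀ + sum (removeAt f i₀) + c   ≡⟨ xy∙z≈xz∙y (f i₀) _ c ⟩
  f i₀ + c + sum (removeAt f i₀)   ≤⟨ +-mono-≤ at (∑-mono-≤ (f≤g ∘ punchIn i₀)) ⟩
  g i₀ + c' + sum (removeAt g i₀)  ≡⟨ xy∙z≈xz∙y (g i₀) _ c' ⟨
  g i₀ + sum (removeAt g i₀) + c'  ≡⟨ cong (_+ c') (sum-remove {i = i₀} g) ⟨
  sum g + c' ∎
  where open ≤-Reasoning

≤-∑ : (f : Fin N → ℕ) (i : Fin N) → f i ≤ ∑[ j < N ] f j
≤-∑ {suc N} f fzero    = m≤m+n (f fzero) _
≤-∑ {suc N} f (fsuc i) = ≤-trans (≤-∑ (f ∘ fsuc) i) (m≤n+m _ (f fzero))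

∑-0 : ∀ N → ∑[ i < N ] 0 ≡ 0
∑-0 = sum-replicate-zero

∑-const : ∀ N c → ∑[ i < N ] c ≡ N * c
∑-const zero    c = refl
∑-const (suc N) c = cong (c +_) (∑-const N c)

∑-1 : ∀ N → ∑[ i < N ] 1 ≡ N
∑-1 N = trans (∑-const N 1) (*-identityʳ N)

listSum-map-tabulate : ∀ {A : Set} (f : A → ℕ) (g : Fin N → A) →
                       List.sum (map f (tabulate g)) ≡ ∑[ i < N ] f (g i)
listSum-map-tabulate {zero}  f g = refl
listSum-map-tabulate {suc N} f g = cong (f (g fzero) +_) (listSum-map-tabulate f (g ∘ fsuc))

module _ {m n : ℕ} where

  ∑ᵥ : (Vertex m n → ℕ) → ℕ
  ∑ᵥ g = ∑[ i < m ] ∑[ k < suc n ] g (i , k)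

  ∑ᵥ-mono-≤-at : ∀ {g h : Vertex m n → ℕ} c c' → (∀ x → g x ≤ h x) → (x₀ : Vertex m n) →
                 g x₀ + c ≤ h x₀ + c' → ∑ᵥ g + c ≤ ∑ᵥ h + c'
  ∑ᵥ-mono-≤-at c c' g≤h (i₀ , k₀) at =
    ∑-mono-≤-at c c' (λ i → ∑-mono-≤ (λ k → g≤h (i , k))) i₀ (∑-mono-≤-at c c' (λ k → g≤h (i₀ , k)) k₀ at)

  ∑ᵥ-*ˡ : ∀ c (g : Vertex m n → ℕ) → ∑ᵥ (λ x → c * g x) ≡ c * ∑ᵥ g
  ∑ᵥ-*ˡ c g = trans (sum-cong-≗ {m} (λ i → sym (*-distribˡ-sum c (λ k → g (i , k)))))
                    (sym (*-distribˡ-sum c (λ i → ∑[ k < suc n ] g (i , k))))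

cost≡∑ᵥ : ∀ m n f → cost m n f ≡ ∑ᵥ f
cost≡∑ᵥ m n f = trans (listSum-map-tabulate {m} _ id)
                      (sum-cong-≗ {m} (λ i → listSum-map-tabulate {suc n} (λ k → f (i , k)) id))

𝟙 : Dec P → ℕ
𝟙 (yes _) = 1
𝟙 (no _)  = 0

𝟙-yes : (d : Dec P) → P → 𝟙 d ≡ 1
𝟙-yes (yes _) _ = refl
𝟙-yes (no ¬p) p = contradiction p ¬p

𝟙-mono : (d : Dec P) (e : Dec Q) → (P → Q) → 𝟙 d ≤ 𝟙 e
𝟙-mono (yes _) (yes _) _   = ≤-refl
𝟙-mono (yes p) (no ¬q) p⇒q = contradiction (p⇒q p) ¬q
𝟙-mono (no _)  _       _   = z≤n

∑-𝟙-≡-≤1 : ∀ N b → ∑[ a < N ] 𝟙 (toℕ a ≟ b) ≤ 1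
∑-𝟙-≡-≤1 zero    b       = z≤n
∑-𝟙-≡-≤1 (suc N) zero    = s≤s (≤-reflexive (∑-0 N))
∑-𝟙-≡-≤1 (suc N) (suc b) =
  ≤-trans (∑-mono-≤ {N} (λ a → 𝟙-mono _ (toℕ a ≟ b) suc-injective)) (∑-𝟙-≡-≤1 N b)

count-≤-image : ∀ N {P : ℕ → Set} (P? : ∀ a → Dec (P a)) (φ : ℕ → ℕ) →
                (∀ a → a < N → P a → ∃[ s ] s < K × a ≡ φ s) → ∑[ a < N ] 𝟙 (P? (toℕ a)) ≤ K
count-≤-image {K} N P? φ covered = begin
  ∑[ a < N ] 𝟙 (P? (toℕ a))                    ≤⟨ ∑-mono-≤ {N} hit ⟩
  ∑[ a < N ] ∑[ s < K ] 𝟙 (toℕ a ≟ φ (toℕ s))  ≡⟨ ∑-comm {N} {K} _ ⟩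
  ∑[ s < K ] ∑[ a < N ] 𝟙 (toℕ a ≟ φ (toℕ s))  ≤⟨ ∑-mono-≤ {K} (λ s → ∑-𝟙-≡-≤1 N (φ (toℕ s))) ⟩
  ∑[ s < K ] 1                                  ≡⟨ ∑-1 K ⟩
  K                                             ∎
  where
  open ≤-Reasoning
  hit : ∀ a → 𝟙 (P? (toℕ a)) ≤ ∑[ s < K ] 𝟙 (toℕ a ≟ φ (toℕ s))
  hit a with P? (toℕ a)
  ... | no _  = z≤n
  ... | yes p with covered (toℕ a) (toℕ<n a) p
  ...   | s , s<K , a≡φs = begin
    1                                    ≡⟨ 𝟙-yes (toℕ a ≟ _) (trans a≡φs (cong φ (sym (toℕ-fromℕ< s<K)))) ⟨
    𝟙 (toℕ a ≟ φ (toℕ (fromℕ< s<K)))     ≤⟨ ≤-∑ _ (fromℕ< s<K) ⟩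
    ∑[ s < K ] 𝟙 (toℕ a ≟ φ (toℕ s))     ∎

count-≤ : ∀ N t → ∑[ a < N ] 𝟙 (toℕ a ≤? t) ≤ suc t
count-≤ N t = count-≤-image N (_≤? t) (λ a → a) (λ a _ a≤t → a , s≤s a≤t , refl)

covered-≤-∑∑ : (w : Fin K → Fin N → ℕ) → (∀ b → ∃[ a ] 1 ≤ w a b) →
               N ≤ ∑[ a < K ] ∑[ b < N ] w a b
covered-≤-∑∑ {K} {N} w hit = begin
  N                          ≡⟨ ∑-1 N ⟨
  ∑[ b < N ] 1               ≤⟨ ∑-mono-≤ (λ b → let (a , 1≤w) = hit b in ≤-trans 1≤w (≤-∑ (λ a → w a b) a)) ⟩
  ∑[ b < N ] ∑[ a < K ] w a b ≡⟨ ∑-comm (λ b a → w a b) ⟩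
  ∑[ a < K ] ∑[ b < N ] w a b ∎
  where open ≤-Reasoning

count-guarded : ∀ N {P : ℕ → Set} (P? : ∀ a → Dec (P a)) (F B : ℕ) →
                (1 ≤ F → ∑[ a < N ] 𝟙 (P? (toℕ a)) ≤ B) →
                ∑[ a < N ] 𝟙 ((1 ≤? F) ×-dec P? (toℕ a)) ≤ B
count-guarded N P? zero    B _     = ≤-trans (≤-reflexive (∑-0 N)) z≤n
count-guarded N P? (suc F) B bound =
  ≤-trans (∑-mono-≤ {N} (λ a → 𝟙-mono _ (P? (toℕ a)) proj₂)) (bound (s≤s z≤n))

-- Distances on ℕ and on the cycle

∣-∣≤⇒≤+ : ∀ {x y t} → ∣ x - y ∣ ≤ t → x ≤ t + y
∣-∣≤⇒≤+ {x} {y} {t} d = ≤-trans (m≤n+∣m-n∣ x y) (subst (y + ∣ x - y ∣ ≤_) (+-comm y t) (+-monoʳ-≤ y d))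

≤+⇒∣-∣≤ : ∀ {x y t} → x ≤ t + y → y ≤ t + x → ∣ x - y ∣ ≤ t
≤+⇒∣-∣≤ {x} {y} {t} x≤t+y y≤t+x with ∣m-n∣≡[m∸n]∨[n∸m] x y
... | inj₁ e = subst (_≤ t) (sym e) (m≤n+o⇒m∸n≤o x y (subst (x ≤_) (+-comm t y) x≤t+y))
... | inj₂ e = subst (_≤ t) (sym e) (m≤n+o⇒m∸n≤o y x (subst (y ≤_) (+-comm t x) y≤t+x))

∣-∣≤-sym : ∀ {t} x y → ∣ x - y ∣ ≤ t → ∣ y - x ∣ ≤ t
∣-∣≤-sym {t} x y = subst (_≤ t) (∣-∣-comm x y)

∣-∣-⊓ : ∀ {t} x x' y y' → ∣ x - x' ∣ ≤ t → ∣ y - y' ∣ ≤ t → ∣ x ⊓ y - x' ⊓ y' ∣ ≤ t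
∣-∣-⊓ {t} x x' y y' dx dy =
  ≤+⇒∣-∣≤ (bound x x' y y' dx dy) (bound x' x y' y (∣-∣≤-sym x x' dx) (∣-∣≤-sym y y' dy))
  where
  bound : ∀ a a' b b' → ∣ a - a' ∣ ≤ t → ∣ b - b' ∣ ≤ t → a ⊓ b ≤ t + a' ⊓ b'
  bound a a' b b' da db =
    ≤-trans (⊓-mono-≤ (∣-∣≤⇒≤+ da) (∣-∣≤⇒≤+ db)) (≤-reflexive (sym (+-distribˡ-⊓ t a' b')))

∣-∣-∸ : ∀ {t} c x y → ∣ x - y ∣ ≤ t → ∣ (c ∸ x) - (c ∸ y) ∣ ≤ t
∣-∣-∸ {t} c x y d = ≤+⇒∣-∣≤ (bound x y (∣-∣≤⇒≤+ (∣-∣≤-sym x y d)))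
                             (bound y x (∣-∣≤⇒≤+ d))
  where
  bound : ∀ a b → b ≤ t + a → c ∸ a ≤ t + (c ∸ b)
  bound a b b≤t+a = m≤n+o⇒m∸n≤o c a (begin
    c                  ≤⟨ m≤n+m∸n c b ⟩
    b + (c ∸ b)        ≤⟨ +-monoˡ-≤ (c ∸ b) b≤t+a ⟩
    t + a + (c ∸ b)    ≡⟨ cong (_+ (c ∸ b)) (+-comm t a) ⟩
    a + t + (c ∸ b)    ≡⟨ +-assoc a t (c ∸ b) ⟩
    a + (t + (c ∸ b))  ∎)
    where open ≤-Reasoning

∣-∣-reverse-triangle : ∀ x y a → ∣ ∣ x - a ∣ - ∣ y - a ∣ ∣ ≤ ∣ x - y ∣
∣-∣-reverse-triangle x y a = ≤+⇒∣-∣≤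
  (∣-∣-triangle x y a)
  (≤-trans (∣-∣-triangle y x a) (≤-reflexive (cong (_+ ∣ x - a ∣) (∣-∣-comm y x))))

∣1+n-n∣≡1 : ∀ n → ∣ suc n - n ∣ ≡ 1
∣1+n-n∣≡1 n = trans (m≤n⇒∣n-m∣≡n∸m (n≤1+n n)) (m+n∸n≡m 1 n)

∣-∣≤⇒≡+∸ : ∀ {x c t} → ∣ x - c ∣ ≤ t → ∃[ s ] s < suc (t + t) × x ≡ c + s ∸ t
∣-∣≤⇒≡+∸ {x} {c} {t} d = x + t ∸ c , s≤s s≤2t , sym x≡
  where
  c≤x+t : c ≤ x + t
  c≤x+t = subst (c ≤_) (+-comm t x) (∣-∣≤⇒≤+ (∣-∣≤-sym x c d))
  s≤2t : x + t ∸ c ≤ t + t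
  s≤2t = m≤n+o⇒m∸n≤o (x + t) c (begin
    x + t        ≤⟨ +-monoˡ-≤ t (∣-∣≤⇒≤+ d) ⟩
    t + c + t    ≡⟨ cong (_+ t) (+-comm t c) ⟩
    c + t + t    ≡⟨ +-assoc c t t ⟩
    c + (t + t)  ∎)
    where open ≤-Reasoning
  x≡ : c + (x + t ∸ c) ∸ t ≡ x
  x≡ = trans (cong (_∸ t) (m+[n∸m]≡n c≤x+t)) (m+n∸n≡m x t)

window-count : ∀ N d c t → ∑[ a < N ] 𝟙 (∣ d + toℕ a - c ∣ ≤? t) ≤ suc (t + t)
window-count N d c t = count-≤-image N (λ a → ∣ d + a - c ∣ ≤? t) (λ s → c + s ∸ t ∸ d) shifted
  where
  shifted : ∀ a → a < N → ∣ d + a - c ∣ ≤ t → ∃[ s ] s < suc (t + t) × a ≡ c + s ∸ t ∸ d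
  shifted a _ near with ∣-∣≤⇒≡+∸ near
  ... | s , s<2t+1 , eq = s , s<2t+1 , trans (sym (m+n∸m≡n d a)) (cong (_∸ d) eq)

cycleDist : ℕ → ℕ → ℕ → ℕ
cycleDist m i j = ∣ i - j ∣ ⊓ (m ∸ ∣ i - j ∣)

cycleDist-self : ∀ m i → cycleDist m i i ≡ 0
cycleDist-self m i rewrite ∣n-n∣≡0 i = refl

cycleDist-pos : ∀ {m i j} → i < m → j < m → i ≢ j → 1 ≤ cycleDist m i j
cycleDist-pos {m} {i} {j} i<m j<m i≢j = ⊓-glb
  (n≢0⇒n>0 (i≢j ∘ ∣m-n∣≡0⇒m≡n))
  (m<n⇒0<n∸m (≤-<-trans (∣m-n∣≤m⊔n i j) (⊔-lub i<m j<m)))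

cycleDist-suc : ∀ m i a → ∣ cycleDist m (suc i) a - cycleDist m i a ∣ ≤ 1
cycleDist-suc m i a = ∣-∣-⊓ X Y (m ∸ X) (m ∸ Y) d (∣-∣-∸ m X Y d)
  where
  X = ∣ suc i - a ∣
  Y = ∣ i - a ∣
  d : ∣ X - Y ∣ ≤ 1
  d = subst (∣ ∣ suc i - a ∣ - ∣ i - a ∣ ∣ ≤_) (∣1+n-n∣≡1 i) (∣-∣-reverse-triangle (suc i) i a)

-- The arcs from m' to a have lengths m' ∸ a and a + 1, those from 0 have lengths a and m' ∸ a + 1.
cycleDist-wrap : ∀ m' a → a ≤ m' → ∣ cycleDist (suc m') m' a - cycleDist (suc m') 0 a ∣ ≤ 1
cycleDist-wrap m' a a≤m' = subst (λ z → ∣ z - a ⊓ (suc m' ∸ a) ∣ ≤ 1) (sym last)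
  (subst (λ z → ∣ (m' ∸ a) ⊓ suc a - a ⊓ z ∣ ≤ 1) (sym (+-∸-assoc 1 a≤m')) (swap (m' ∸ a) a))
  where
  last : cycleDist (suc m') m' a ≡ (m' ∸ a) ⊓ suc a
  last rewrite m≤n⇒∣n-m∣≡n∸m a≤m' | +-∸-assoc 1 (m∸n≤m m' a) | m∸[m∸n]≡n a≤m' = refl
  below : ∀ x y → x ⊓ suc y ≤ 1 + y ⊓ suc x
  below x y = ≤-trans (≤-reflexive (⊓-comm x (suc y))) (⊓-monoʳ-≤ (suc y) (≤-trans (n≤1+n x) (n≤1+n (suc x))))
  swap : ∀ x y → ∣ x ⊓ suc y - y ⊓ suc x ∣ ≤ 1
  swap x y = ≤+⇒∣-∣≤ (below x y) (below y x)

[m+n]∸o≡m∸[o∸n] : ∀ m {n o} → n ≤ o → (m + n) ∸ o ≡ m ∸ (o ∸ n)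
[m+n]∸o≡m∸[o∸n] m {n} {o} n≤o = begin
  (m + n) ∸ o            ≡⟨ cong ((m + n) ∸_) (m+[n∸m]≡n n≤o) ⟨
  (m + n) ∸ (n + (o ∸ n)) ≡⟨ cong (_∸ (n + (o ∸ n))) (+-comm m n) ⟩
  (n + m) ∸ (n + (o ∸ n)) ≡⟨ [m+n]∸[m+o]≡n∸o n m (o ∸ n) ⟩
  m ∸ (o ∸ n)            ∎
  where open ≡-Reasoning

[m+a]%m≡a : ∀ {m a} .{{_ : NonZero m}} → a < m → (m + a) % m ≡ a
[m+a]%m≡a {m} {a} a<m = trans (cong (_% m) (+-comm m a)) (trans ([m+n]%n≡m%n a m) (m<n⇒m%n≡m a<m))

-- The target a lies on one of the two arcs from i, i.e. some representative
-- u ≡ a (mod m) among a, m + a, 2m + a is within t of m + i.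
cycleDist-unwrap : ∀ {m i a t} .{{_ : NonZero m}} → i < m → a < m → cycleDist m i a ≤ t →
                   ∃[ u ] u % m ≡ a × ∣ u - (m + i) ∣ ≤ t
cycleDist-unwrap {m} {i} {a} {t} i<m a<m d with ⊓-sel ∣ i - a ∣ (m ∸ ∣ i - a ∣)
... | inj₁ short = m + a , [m+a]%m≡a a<m ,
  subst (_≤ t) (trans (∣-∣-comm i a) (sym (∣m+n-m+o∣≡∣n-o∣ m a i))) (subst (_≤ t) short d)
... | inj₂ long with ≤-total i a
...   | inj₁ i≤a = a , m<n⇒m%n≡m a<m , (begin
  ∣ a - (m + i) ∣       ≡⟨ m≤n⇒∣m-n∣≡n∸m (≤-trans (<⇒≤ a<m) (m≤m+n m i)) ⟩
  (m + i) ∸ a           ≡⟨ [m+n]∸o≡m∸[o∸n] m i≤a ⟩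
  m ∸ (a ∸ i)           ≡⟨ cong (m ∸_) (m≤n⇒∣m-n∣≡n∸m i≤a) ⟨
  m ∸ ∣ i - a ∣         ≡⟨ long ⟨
  cycleDist m i a       ≤⟨ d ⟩
  t                     ∎)
  where open ≤-Reasoning
...   | inj₂ a≤i = m + (m + a) , twice , (begin
  ∣ m + (m + a) - (m + i) ∣ ≡⟨ ∣m+n-m+o∣≡∣n-o∣ m (m + a) i ⟩
  ∣ m + a - i ∣             ≡⟨ m≤n⇒∣n-m∣≡n∸m (≤-trans (<⇒≤ i<m) (m≤m+n m a)) ⟩
  (m + a) ∸ i               ≡⟨ [m+n]∸o≡m∸[o∸n] m a≤i ⟩
  m ∸ (i ∸ a)               ≡⟨ cong (m ∸_) (m≤n⇒∣n-m∣≡n∸m a≤i) ⟨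
  m ∸ ∣ i - a ∣             ≡⟨ long ⟨
  cycleDist m i a           ≤⟨ d ⟩
  t                         ∎)
  where
  open ≤-Reasoning
  twice : (m + (m + a)) % m ≡ a
  twice = trans (cong (_% m) (+-comm m (m + a))) (trans ([m+n]%n≡m%n (m + a) m) ([m+a]%m≡a a<m))

cycleDist-count : ∀ {m i} .{{_ : NonZero m}} t → i < m →
                  ∑[ a < m ] 𝟙 (cycleDist m i (toℕ a) ≤? t) ≤ suc (t + t)
cycleDist-count {m} {i} t i<m =
  count-≤-image m (λ a → cycleDist m i a ≤? t) (λ s → (m + i + s ∸ t) % m) on-arc
  where
  on-arc : ∀ a → a < m → cycleDist m i a ≤ t → ∃[ s ] s < suc (t + t) × a ≡ (m + i + s ∸ t) % m
  on-arc a a<m d with cycleDist-unwrap i<m a<m d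
  ... | u , u%m≡a , near with ∣-∣≤⇒≡+∸ near
  ...   | s , s<2t+1 , u≡ = s , s<2t+1 , trans (sym u%m≡a) (cong (_% m) u≡)

cycleDist-step : ∀ {m} {i j : Fin m} → CycleStep m i j → (a : Fin m) →
                 ∣ cycleDist m (toℕ i) (toℕ a) - cycleDist m (toℕ j) (toℕ a) ∣ ≤ 1
cycleDist-step {m} (next i j j≡1+i) a rewrite j≡1+i =
  ∣-∣≤-sym (cycleDist m (suc (toℕ i)) (toℕ a)) _ (cycleDist-suc m (toℕ i) (toℕ a))
cycleDist-step {suc m'} (wrap i j i≡m' j≡0) a rewrite i≡m' | j≡0 =
  cycleDist-wrap m' (toℕ a) (s≤s⁻¹ (toℕ<n a))

-- Lipschitz potentials on the sunlet graph

inject₁-step : ∀ {n} (k : Fin n) → ∣ toℕ (inject₁ k) - suc (toℕ k) ∣ ≤ 1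
inject₁-step k rewrite toℕ-inject₁ k = ≤-reflexive (trans (∣-∣-comm (toℕ k) _) (∣1+n-n∣≡1 (toℕ k)))

module _ {m n : ℕ} where

  Lipschitz : (Vertex m n → ℕ) → Set
  Lipschitz P = ∀ {u v} → Adj m n u v → ∣ P u - P v ∣ ≤ 1

  Lipschitz-DistLe : ∀ P {u v t} → Lipschitz P → DistLe m n u v t → ∣ P u - P v ∣ ≤ t
  Lipschitz-DistLe P lip (l , l≤t , walk) = ≤-trans (along walk) l≤t
    where
    along : ∀ {u v l} → Walk m n u v l → ∣ P u - P v ∣ ≤ l
    along (here u)            = ≤-reflexive (∣n-n∣≡0 (P u))
    along (step {u} {v} {w} uv walk) =
      ≤-trans (∣-∣-triangle (P u) (P v) (P w)) (+-mono-≤ (lip uv) (along walk))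

  depth : Vertex m n → ℕ
  depth (_ , k) = toℕ k

  depth-Lipschitz : Lipschitz depth
  depth-Lipschitz (cyc _)    = z≤n
  depth-Lipschitz (cyc⁻¹ _)  = z≤n
  depth-Lipschitz (down _ k) = inject₁-step k
  depth-Lipschitz (up _ k)   = ∣-∣≤-sym (toℕ (inject₁ k)) _ (inject₁-step k)

  -- fromLeaf a v is the distance from the leaf (a , n) to v.
  fromLeaf : Fin m → Vertex m n → ℕ
  fromLeaf a (i , k) = value (i Fin.≟ a)
    where
    value : Dec (i ≡ a) → ℕ
    value (yes _) = n ∸ toℕ k
    value (no _)  = cycleDist m (toℕ i) (toℕ a) + (n + toℕ k)

  fromLeaf-base : ∀ a i → fromLeaf a (i , fzero) ≡ n + cycleDist m (toℕ i) (toℕ a)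
  fromLeaf-base a i with i Fin.≟ a
  ... | yes refl rewrite cycleDist-self m (toℕ a) = sym (+-identityʳ n)
  ... | no _     = trans (cong (cycleDist m (toℕ i) (toℕ a) +_) (+-identityʳ n)) (+-comm _ n)

  fromLeaf-cycleStep : ∀ a {i j} → CycleStep m i j → ∣ fromLeaf a (i , fzero) - fromLeaf a (j , fzero) ∣ ≤ 1
  fromLeaf-cycleStep a {i} {j} s rewrite fromLeaf-base a i | fromLeaf-base a j
    | ∣m+n-m+o∣≡∣n-o∣ n (cycleDist m (toℕ i) (toℕ a)) (cycleDist m (toℕ j) (toℕ a)) = cycleDist-step s a

  fromLeaf-branchStep : ∀ a i k → ∣ fromLeaf a (i , inject₁ k) - fromLeaf a (i , fsuc k) ∣ ≤ 1
  fromLeaf-branchStep a i k with i Fin.≟ a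
  ... | yes _ = ∣-∣-∸ n (toℕ (inject₁ k)) (suc (toℕ k)) (inject₁-step k)
  ... | no _ rewrite ∣m+n-m+o∣≡∣n-o∣ (cycleDist m (toℕ i) (toℕ a)) (n + toℕ (inject₁ k)) (n + suc (toℕ k))
                   | ∣m+n-m+o∣≡∣n-o∣ n (toℕ (inject₁ k)) (suc (toℕ k)) = inject₁-step k

  fromLeaf-Lipschitz : ∀ a → Lipschitz (fromLeaf a)
  fromLeaf-Lipschitz a (cyc s)           = fromLeaf-cycleStep a s
  fromLeaf-Lipschitz a (cyc⁻¹ {i} {j} s) = ∣-∣≤-sym (fromLeaf a (i , fzero)) _ (fromLeaf-cycleStep a s)
  fromLeaf-Lipschitz a (down i k)        = fromLeaf-branchStep a i k
  fromLeaf-Lipschitz a (up i k)          = ∣-∣≤-sym (fromLeaf a (i , inject₁ k)) _ (fromLeaf-branchStep a i k)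

  fromLeaf-own : ∀ a d → fromLeaf a (a , d) ≡ n ∸ toℕ d
  fromLeaf-own a d with a Fin.≟ a
  ... | yes _   = refl
  ... | no a≢a  = contradiction refl a≢a

  fromLeaf-off : ∀ a i k → i ≢ a → fromLeaf a (i , k) ≡ cycleDist m (toℕ i) (toℕ a) + (n + toℕ k)
  fromLeaf-off a i k i≢a with i Fin.≟ a
  ... | yes i≡a = contradiction i≡a i≢a
  ... | no _    = refl

  DistLe-depth : ∀ {u v t} → DistLe m n u v t → ∣ depth u - depth v ∣ ≤ t
  DistLe-depth = Lipschitz-DistLe depth depth-Lipschitz

  DistLe-offBranch : ∀ {a d i k t} → DistLe m n (a , d) (i , k) t → i ≢ a →
                     cycleDist m (toℕ i) (toℕ a) + (toℕ d + toℕ k) ≤ t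
  DistLe-offBranch {a} {d} {i} {k} {t} dist i≢a = +-cancelˡ-≤ n _ _ (begin
    n + (c + (toℕ d + toℕ k))          ≡⟨ rearrange n c (toℕ d) (toℕ k) ⟩
    c + (n + toℕ k) + toℕ d            ≡⟨ cong (_+ toℕ d) (fromLeaf-off a i k i≢a) ⟨
    fromLeaf a (i , k) + toℕ d         ≤⟨ +-monoˡ-≤ (toℕ d) (∣-∣≤⇒≤+ near) ⟩
    t + fromLeaf a (a , d) + toℕ d     ≡⟨ cong (λ x → t + x + toℕ d) (fromLeaf-own a d) ⟩
    t + (n ∸ toℕ d) + toℕ d            ≡⟨ +-assoc t (n ∸ toℕ d) (toℕ d) ⟩
    t + (n ∸ toℕ d + toℕ d)            ≡⟨ cong (t +_) (m∸n+n≡m (s≤s⁻¹ (toℕ<n d))) ⟩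
    t + n                              ≡⟨ +-comm t n ⟩
    n + t                              ∎)
    where
    open ≤-Reasoning
    c = cycleDist m (toℕ i) (toℕ a)
    near : ∣ fromLeaf a (i , k) - fromLeaf a (a , d) ∣ ≤ t
    near = ∣-∣≤-sym (fromLeaf a (a , d)) _ (Lipschitz-DistLe (fromLeaf a) (fromLeaf-Lipschitz a) dist)
    rearrange : ∀ n c d k → n + (c + (d + k)) ≡ c + (n + k) + d
    rearrange = solve-∀

-- A dominating broadcast of cost n + ⌊m/2⌋

module _ {m n : ℕ} where

  _++ᵂ_ : ∀ {u v w a b} → Walk m n u v a → Walk m n v w b → Walk m n u w (a + b)
  here _      ++ᵂ q = q
  step uv p   ++ᵂ q = step uv (p ++ᵂ q)

  climb : ∀ {i} d (k : Fin (suc n)) → toℕ k ≡ d → Walk m n (i , k) (i , fzero) d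
  climb zero    fzero    _ = here _
  climb (suc d) (fsuc k) e = step (up _ k) (climb d (inject₁ k) (trans (toℕ-inject₁ k) (suc-injective e)))

module Hub (m' n : ℕ) where

  m : ℕ
  m = suc m'

  backward : ∀ d (i : Fin m) → toℕ i ≡ d → Walk m n (i , fzero) (fzero , fzero) d
  backward zero    fzero _ = here _
  backward (suc d) i     e = step (cyc⁻¹ (next j i (trans e (cong suc (sym (toℕ-fromℕ< d<m))))))
                                  (backward d j (toℕ-fromℕ< d<m))
    where
    d<m : d < m
    d<m = <-trans (n<1+n d) (subst (_< m) e (toℕ<n i))
    j = fromℕ< d<m

  forward : ∀ d (i : Fin m) → toℕ i + d ≡ m → Walk m n (i , fzero) (fzero , fzero) d
  forward zero          i e = contradiction (trans (sym (+-identityʳ (toℕ i))) e) (<⇒≢ (toℕ<n i))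
  forward (suc zero)    i e =
    step (cyc (wrap i fzero (suc-injective (trans (+-comm 1 (toℕ i)) e)) refl)) (here _)
  forward (suc (suc d)) i e = step (cyc (next i j (toℕ-fromℕ< 1+i<m))) (forward (suc d) j j+d≡m)
    where
    1+i<m : suc (toℕ i) < m
    1+i<m = subst (suc (toℕ i) <_) e (≤-trans (s≤s (s≤s (m≤m+n (toℕ i) d)))
              (≤-reflexive (sym (trans (+-suc (toℕ i) (suc d)) (cong suc (+-suc (toℕ i) d))))))
    j = fromℕ< 1+i<m
    j+d≡m : toℕ j + suc d ≡ m
    j+d≡m = trans (cong (_+ suc d) (toℕ-fromℕ< 1+i<m)) (trans (sym (+-suc (toℕ i) (suc d))) e)

  m≤1+[m/2]*2 : m ≤ suc (m / 2 * 2)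
  m≤1+[m/2]*2 = ≤-trans (≤-reflexive (m≡m%n+[m/n]*n m 2)) (+-monoˡ-≤ (m / 2 * 2) (s≤s⁻¹ (m%n<n m 2)))

  toHub : ∀ i → ∃[ c ] c ≤ m / 2 × Walk m n (i , fzero) (fzero , fzero) c
  toHub i with toℕ i ≤? m / 2
  ... | yes i≤h = toℕ i , i≤h , backward (toℕ i) i refl
  ... | no  i≰h = m ∸ toℕ i , m∸i≤h , forward (m ∸ toℕ i) i (m+[n∸m]≡n (<⇒≤ (toℕ<n i)))
    where
    h = m / 2
    m∸i≤h : m ∸ toℕ i ≤ h
    m∸i≤h = m≤n+o⇒m∸n≤o m (toℕ i) (begin
      m             ≤⟨ m≤1+[m/2]*2 ⟩
      suc (h * 2)   ≡⟨ cong suc (*-comm h 2) ⟩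
      suc (h + (h + 0))  ≡⟨ cong (λ x → suc (h + x)) (+-identityʳ h) ⟩
      suc h + h     ≤⟨ +-monoˡ-≤ h (≰⇒> i≰h) ⟩
      toℕ i + h     ∎)
      where open ≤-Reasoning

  hub : Vertex m n → ℕ
  hub (fzero , fzero) = n + m / 2
  hub _               = 0

  hub-dominating : 1 ≤ n → Dominating m n hub
  hub-dominating 1≤n (i , k) with toHub i
  ... | c , c≤h , walk = (fzero , fzero) , ≤-trans 1≤n (m≤m+n n _) ,
    (toℕ k + c , +-mono-≤ (s≤s⁻¹ (toℕ<n k)) c≤h , climb (toℕ k) k refl ++ᵂ walk)

  hub-cost : cost m n hub ≡ n + m / 2
  hub-cost = begin
    cost m n hub
      ≡⟨ cost≡∑ᵥ m n hub ⟩
    (n + m / 2 + ∑[ k < n ] 0) + ∑[ i < m' ] ∑[ k < suc n ] 0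
      ≡⟨ cong₂ _+_ (cong (n + m / 2 +_) (∑-0 n)) (trans (sum-cong-≗ {m'} (λ _ → ∑-0 (suc n))) (∑-0 m')) ⟩
    n + m / 2 + 0 + 0
      ≡⟨ trans (+-identityʳ _) (+-identityʳ _) ⟩
    n + m / 2
      ∎
    where open ≡-Reasoning

-- Lower bounds

argmax : ∀ N (g : Fin (suc N) → ℕ) → ∃[ a ] (∀ b → g b ≤ g a)
argmax zero    g = fzero , λ { fzero → ≤-refl }
argmax (suc N) g with argmax N (g ∘ fsuc)
... | a , max with g fzero ≤? g (fsuc a)
...   | yes g0≤ = fsuc a , λ { fzero → g0≤ ; (fsuc b) → max b }
...   | no  g0≰ = fzero  , λ { fzero → ≤-refl ; (fsuc b) → ≤-trans (max b) (<⇒≤ (≰⇒> g0≰)) }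

argmaxᵥ : ∀ {m' n} (g : Vertex (suc m') n → ℕ) → ∃[ x ] (∀ y → g y ≤ g x)
argmaxᵥ {m'} {n} g with argmax m' (λ i → g (i , proj₁ (argmax n (λ k → g (i , k)))))
... | i , max = (i , _) , λ (j , k) → ≤-trans (proj₂ (argmax n (λ k → g (j , k))) k) (max j)

1+2[m∸n]≤2m : ∀ m n → 1 ≤ m → 1 ≤ n → suc ((m ∸ n) + (m ∸ n)) ≤ 2 * m
1+2[m∸n]≤2m (suc m) (suc n) _ _ = begin
  suc ((m ∸ n) + (m ∸ n))  ≤⟨ s≤s (+-mono-≤ (m∸n≤m m n) (m∸n≤m m n)) ⟩
  suc (m + m)              ≤⟨ n≤1+n _ ⟩
  suc (suc (m + m))        ≡⟨ double m ⟨
  2 * suc m                ∎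
  where
  open ≤-Reasoning
  double : ∀ m → 2 * suc m ≡ suc (suc (m + m))
  double = solve-∀

1+2[m∸[n+k]]+2n≤2m+1 : ∀ m n k → n ≤ m ∸ k → suc ((m ∸ (n + k)) + (m ∸ (n + k))) + 2 * n ≤ 2 * m + 1
1+2[m∸[n+k]]+2n≤2m+1 m n k n≤m∸k = begin
  suc (t + t) + 2 * n                    ≡⟨ cong (λ x → suc (x + x) + 2 * n) t≡ ⟩
  suc (e ∸ n + (e ∸ n)) + 2 * n          ≡⟨ regroup (e ∸ n) n ⟩
  2 * (e ∸ n + n) + 1                    ≡⟨ cong (λ x → 2 * x + 1) (m∸n+n≡m n≤m∸k) ⟩
  2 * e + 1                              ≤⟨ +-monoˡ-≤ 1 (*-monoʳ-≤ 2 (m∸n≤m m k)) ⟩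
  2 * m + 1                              ∎
  where
  open ≤-Reasoning
  t = m ∸ (n + k)
  e = m ∸ k
  t≡ : t ≡ e ∸ n
  t≡ = trans (cong (m ∸_) (+-comm n k)) (sym (∸-+-assoc m k n))
  regroup : ∀ t n → suc (t + t) + 2 * n ≡ 2 * (t + n) + 1
  regroup = solve-∀

1+2m≤3m : ∀ m → 1 ≤ m → suc (m + m) ≤ 3 * m
1+2m≤3m (suc m) _ = ≤-trans (m≤m+n _ m) (≤-reflexive (triple m))
  where
  triple : ∀ m → suc (suc m + suc m) + m ≡ 3 * suc m
  triple = solve-∀

module Leaves {m n : ℕ} .{{_ : NonZero m}} (f : Vertex m n → ℕ) where

  -- An over-approximation of the leaves reached from (i , k): its own leaf always counts.
  reachesLeaf : Vertex m n → Fin m → ℕ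
  reachesLeaf (i , k) j =
    𝟙 ((1 ≤? f (i , k)) ×-dec (cycleDist m (toℕ i) (toℕ j) ≤? f (i , k) ∸ (n + toℕ k)))

  leaves-covered : Dominating m n f → ∀ j → ∃[ x ] 1 ≤ reachesLeaf x j
  leaves-covered dom j with dom (j , fromℕ n)
  ... | (i , k) , 1≤F , dist = (i , k) , ≤-reflexive (sym (𝟙-yes _ (1≤F , reach)))
    where
    reach : cycleDist m (toℕ i) (toℕ j) ≤ f (i , k) ∸ (n + toℕ k)
    reach with i Fin.≟ j
    ... | yes refl = subst (_≤ _) (sym (cycleDist-self m (toℕ i))) z≤n
    ... | no  i≢j  = m+n≤o⇒m≤o∸n _ (subst (λ d → cycleDist m (toℕ i) (toℕ j) + (d + toℕ k) ≤ f (i , k))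
                                          (toℕ-fromℕ n) (DistLe-offBranch dist i≢j))

  reachesLeaf-count : 1 ≤ n → ∀ x → ∑[ j < m ] reachesLeaf x j ≤ 2 * f x
  reachesLeaf-count 1≤n (i , k) = count-guarded m (λ a → cycleDist m (toℕ i) a ≤? t) F (2 * F) λ 1≤F →
    ≤-trans (cycleDist-count t (toℕ<n i)) (1+2[m∸n]≤2m F (n + toℕ k) 1≤F (≤-trans 1≤n (m≤m+n n (toℕ k))))
    where
    F = f (i , k)
    t = F ∸ (n + toℕ k)

  reachesLeaf-count-at : ∀ x → n ≤ f x ∸ depth x → ∑[ j < m ] reachesLeaf x j + 2 * n ≤ 2 * f x + 1
  reachesLeaf-count-at (i , k) n≤excess = ≤-trans
    (+-monoˡ-≤ (2 * n) (≤-trans (∑-mono-≤ {m} (λ j → 𝟙-mono _ (cycleDist m (toℕ i) (toℕ j) ≤? t) proj₂))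
                                (cycleDist-count t (toℕ<n i))))
    (1+2[m∸[n+k]]+2n≤2m+1 (f (i , k)) n (toℕ k) n≤excess)
    where
    t = f (i , k) ∸ (n + toℕ k)

  leaves-bound : 1 ≤ n → Dominating m n f → ∀ x₀ → n ≤ f x₀ ∸ depth x₀ → m + 2 * n ≤ 2 * ∑ᵥ f + 1
  leaves-bound 1≤n dom x₀ n≤excess = begin
    m + 2 * n
      ≤⟨ +-monoˡ-≤ (2 * n) (covered-≤-∑∑ hits covered) ⟩
    ∑[ i < m ] ∑[ j < m ] ∑[ k < suc n ] reachesLeaf (i , k) j + 2 * n
      ≡⟨ cong (_+ 2 * n) (sum-cong-≗ {m} (λ i → ∑-comm {m} {suc n} (λ j k → reachesLeaf (i , k) j))) ⟩
    ∑ᵥ (λ x → ∑[ j < m ] reachesLeaf x j) + 2 * n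
      ≤⟨ ∑ᵥ-mono-≤-at (2 * n) 1 (reachesLeaf-count 1≤n) x₀ (reachesLeaf-count-at x₀ n≤excess) ⟩
    ∑ᵥ (λ x → 2 * f x) + 1
      ≡⟨ cong (_+ 1) (∑ᵥ-*ˡ 2 f) ⟩
    2 * ∑ᵥ f + 1
      ∎
    where
    open ≤-Reasoning
    hits : Fin m → Fin m → ℕ
    hits i j = ∑[ k < suc n ] reachesLeaf (i , k) j
    covered : ∀ j → ∃[ i ] 1 ≤ hits i j
    covered j with leaves-covered dom j
    ... | (i , k) , hit = i , ≤-trans hit (≤-∑ (λ k → reachesLeaf (i , k) j) k)

module Levels {m n : ℕ} (f : Vertex m n → ℕ) (E : ℕ) (E<n : E < n)
              (excess≤E : ∀ x → f x ∸ depth x ≤ E) where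

  -- R counts the levels E, E + 1, …, n of a branch.
  R : ℕ
  R = suc (n ∸ E)

  level : Fin R → Fin (suc n)
  level e = fromℕ< (s≤s (subst (E + toℕ e ≤_) (m+[n∸m]≡n (<⇒≤ E<n)) (+-monoʳ-≤ E (s≤s⁻¹ (toℕ<n e)))))

  toℕ-level : ∀ e → toℕ (level e) ≡ E + toℕ e
  toℕ-level e = toℕ-fromℕ< _

  reachesLevel : Fin m → Fin (suc n) → Fin R → ℕ
  reachesLevel j k e = 𝟙 ((1 ≤? f (j , k)) ×-dec (∣ E + toℕ e - toℕ k ∣ ≤? f (j , k)))

  -- A broadcast from another branch would need power at least depth + E + 1,
  -- exceeding the maximal excess E.
  levels-covered : Dominating m n f → ∀ j e → ∃[ k ] 1 ≤ reachesLevel j k e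
  levels-covered dom j e with dom (j , level e)
  ... | (i , k) , 1≤F , dist with i Fin.≟ j
  ...   | yes refl = k , ≤-reflexive (sym (𝟙-yes _ (1≤F , near)))
    where
    near : ∣ E + toℕ e - toℕ k ∣ ≤ f (i , k)
    near = subst (λ d → ∣ d - toℕ k ∣ ≤ f (i , k)) (toℕ-level e) (DistLe-depth dist)
  ...   | no  i≢j  = contradiction far (<-irrefl refl)
    where
    F = f (i , k)
    far : E + toℕ k < E + toℕ k
    far = begin-strict
      E + toℕ k
        <⟨ s≤s (+-monoˡ-≤ (toℕ k) (m≤m+n E (toℕ e))) ⟩
      1 + (E + toℕ e + toℕ k)
        ≤⟨ +-monoˡ-≤ _ (cycleDist-pos (toℕ<n i) (toℕ<n j) (i≢j ∘ toℕ-injective)) ⟩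
      cycleDist m (toℕ i) (toℕ j) + (E + toℕ e + toℕ k)
        ≡⟨ cong (λ d → cycleDist m (toℕ i) (toℕ j) + (d + toℕ k)) (toℕ-level e) ⟨
      cycleDist m (toℕ i) (toℕ j) + (toℕ (level e) + toℕ k)
        ≤⟨ DistLe-offBranch dist i≢j ⟩
      F
        ≤⟨ m≤n+m∸n F (toℕ k) ⟩
      toℕ k + (F ∸ toℕ k)
        ≤⟨ +-monoʳ-≤ (toℕ k) (excess≤E (i , k)) ⟩
      toℕ k + E
        ≡⟨ +-comm (toℕ k) E ⟩
      E + toℕ k
        ∎
      where open ≤-Reasoning

  reachesLevel-count : ∀ j k → ∑[ e < R ] reachesLevel j k e ≤ 3 * f (j , k)
  reachesLevel-count j k = count-guarded R (λ a → ∣ E + a - toℕ k ∣ ≤? F) F (3 * F) λ 1≤F →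
    ≤-trans (window-count R E (toℕ k) F) (1+2m≤3m F 1≤F)
    where
    F = f (j , k)

  -- With power E + k, the vertex (j , k) reaches only the levels E + e with e ≤ 2k.
  reachesLevel-count-at : ∀ j k → f (j , k) ≡ E + toℕ k →
                        ∑[ e < R ] reachesLevel j k e + (3 * E + toℕ k) ≤ 3 * f (j , k) + 1
  reachesLevel-count-at j k F≡E+k = begin
    ∑[ e < R ] reachesLevel j k e + (3 * E + d)
      ≤⟨ +-monoˡ-≤ _ (∑-mono-≤ {R} λ e → 𝟙-mono (reached? e) (toℕ e ≤? d + d) (below e ∘ proj₂)) ⟩
    ∑[ e < R ] 𝟙 (toℕ e ≤? d + d) + (3 * E + d)
      ≤⟨ +-monoˡ-≤ _ (count-≤ R (d + d)) ⟩
    suc (d + d) + (3 * E + d)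
      ≡⟨ regroup E d ⟩
    3 * (E + d) + 1
      ≡⟨ cong (λ F → 3 * F + 1) F≡E+k ⟨
    3 * f (j , k) + 1
      ∎
    where
    open ≤-Reasoning
    d = toℕ k
    reached? = λ (e : Fin R) → (1 ≤? f (j , k)) ×-dec (∣ E + toℕ e - d ∣ ≤? f (j , k))
    below : ∀ e → ∣ E + toℕ e - d ∣ ≤ f (j , k) → toℕ e ≤ d + d
    below e near = +-cancelˡ-≤ E _ _ (begin
      E + toℕ e          ≤⟨ ∣-∣≤⇒≤+ near ⟩
      f (j , k) + d      ≡⟨ cong (_+ d) F≡E+k ⟩
      E + d + d          ≡⟨ +-assoc E d d ⟩
      E + (d + d)        ∎)
    regroup : ∀ E d → suc (d + d) + (3 * E + d) ≡ 3 * (E + d) + 1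
    regroup = solve-∀

  branch-bound : Dominating m n f → ∀ j → R ≤ 3 * ∑[ k < suc n ] f (j , k)
  branch-bound dom j = begin
    R                                            ≤⟨ covered-≤-∑∑ (reachesLevel j) (levels-covered dom j) ⟩
    ∑[ k < suc n ] ∑[ e < R ] reachesLevel j k e   ≤⟨ ∑-mono-≤ {suc n} (reachesLevel-count j) ⟩
    ∑[ k < suc n ] (3 * f (j , k))                 ≡⟨ *-distribˡ-sum 3 (λ k → f (j , k)) ⟨
    3 * ∑[ k < suc n ] f (j , k)                 ∎
    where open ≤-Reasoning

  branch-bound-at : Dominating m n f → ∀ j k → f (j , k) ≡ E + toℕ k →
                    R + 3 * E ≤ 3 * ∑[ k < suc n ] f (j , k) + 1
  branch-bound-at dom j k F≡E+k = begin
    R + 3 * E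
      ≤⟨ +-monoʳ-≤ R (m≤m+n (3 * E) (toℕ k)) ⟩
    R + (3 * E + toℕ k)
      ≤⟨ +-monoˡ-≤ _ (covered-≤-∑∑ (reachesLevel j) (levels-covered dom j)) ⟩
    ∑[ k < suc n ] ∑[ e < R ] reachesLevel j k e + (3 * E + toℕ k)
      ≤⟨ ∑-mono-≤-at _ 1 (reachesLevel-count j) k (reachesLevel-count-at j k F≡E+k) ⟩
    ∑[ k < suc n ] (3 * f (j , k)) + 1
      ≡⟨ cong (_+ 1) (*-distribˡ-sum 3 (λ k → f (j , k))) ⟨
    3 * ∑[ k < suc n ] f (j , k) + 1
      ∎
    where open ≤-Reasoning

  levels-bound : Dominating m n f → ∀ x → f x ∸ depth x ≡ E → m * R + 3 * E ≤ 3 * ∑ᵥ f + 1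
  levels-bound dom (j , k) excess≡E with E ≟ 0
  ... | yes E≡0 = begin
    m * R + 3 * E                          ≡⟨ cong (λ e → m * R + 3 * e) E≡0 ⟩
    m * R + 0                              ≡⟨ +-identityʳ _ ⟩
    m * R                                  ≡⟨ ∑-const m R ⟨
    ∑[ j < m ] R                           ≤⟨ ∑-mono-≤ {m} (branch-bound dom) ⟩
    ∑[ j < m ] (3 * ∑[ k < suc n ] f (j , k)) ≡⟨ *-distribˡ-sum 3 (λ j → ∑[ k < suc n ] f (j , k)) ⟨
    3 * ∑ᵥ f                               ≤⟨ m≤m+n _ 1 ⟩
    3 * ∑ᵥ f + 1                           ∎
    where open ≤-Reasoning
  ... | no E≢0 = begin
    m * R + 3 * E
      ≡⟨ cong (_+ 3 * E) (∑-const m R) ⟨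
    ∑[ j < m ] R + 3 * E
      ≤⟨ ∑-mono-≤-at (3 * E) 1 (branch-bound dom) j (branch-bound-at dom j k F≡E+k) ⟩
    ∑[ j < m ] (3 * ∑[ k < suc n ] f (j , k)) + 1
      ≡⟨ cong (_+ 1) (*-distribˡ-sum 3 (λ j → ∑[ k < suc n ] f (j , k))) ⟨
    3 * ∑ᵥ f + 1
      ∎
    where
    open ≤-Reasoning
    F≡E+k : f (j , k) ≡ E + toℕ k
    k<F : toℕ k < f (j , k)
    k<F = m∸n≢0⇒n<m (λ F∸k≡0 → E≢0 (trans (sym excess≡E) F∸k≡0))
    F≡E+k = trans (sym (m∸n+n≡m (<⇒≤ k<F))) (cong (_+ toℕ k) excess≡E)

2*[m/2]≤m : ∀ m → 2 * (m / 2) ≤ m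
2*[m/2]≤m m = subst (_≤ m) (*-comm (m / 2) 2) (m/n*n≤m m 2)

≤-cancel-*-slack : ∀ k {a c} → suc k * a ≤ suc k * c + k → a ≤ c
≤-cancel-*-slack k {a} {c} le =
  s≤s⁻¹ (*-cancelˡ-< (suc k) a (suc c) (≤-trans (s≤s le) (≤-reflexive (sym (eq k c)))))
  where
  eq : ∀ k c → suc k * suc c ≡ suc (suc k * c + k)
  eq = solve-∀

from-leaves : ∀ m n c → m + 2 * n ≤ 2 * c + 1 → n + m / 2 ≤ c
from-leaves m n c le = ≤-cancel-*-slack 1 (begin
  2 * (n + m / 2)      ≡⟨ *-distribˡ-+ 2 n (m / 2) ⟩
  2 * n + 2 * (m / 2)  ≤⟨ +-monoʳ-≤ (2 * n) (2*[m/2]≤m m) ⟩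
  2 * n + m            ≡⟨ +-comm (2 * n) m ⟩
  m + 2 * n            ≤⟨ le ⟩
  2 * c + 1            ∎)
  where open ≤-Reasoning

from-levels : ∀ {m} E d c → 3 ≤ m → 1 ≤ d → m * suc d + 3 * E ≤ 3 * c + 1 → E + d + m / 2 ≤ c
from-levels E (suc r) c (s≤s (s≤s (s≤s (z≤n {p})))) _ le = ≤-cancel-*-slack 2 (begin
  3 * (E + suc r + h)                      ≡⟨ expand E r h ⟩
  3 * E + 3 + 3 * r + 3 * h                ≤⟨ +-monoʳ-≤ (3 * E + 3 + 3 * r) 3h≤4+2p ⟩
  3 * E + 3 + 3 * r + (4 + 2 * p)          ≤⟨ m≤m+n _ (p * r) ⟩
  3 * E + 3 + 3 * r + (4 + 2 * p) + p * r  ≡⟨ collect E r p ⟩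
  (3 + p) * suc (suc r) + 3 * E + 1        ≤⟨ +-monoˡ-≤ 1 le ⟩
  3 * c + 1 + 1                            ≡⟨ +-assoc (3 * c) 1 1 ⟩
  3 * c + 2                                ∎)
  where
  open ≤-Reasoning
  h = (3 + p) / 2
  h≤1+p : h ≤ suc p
  h≤1+p = ≤-cancel-*-slack 1 (≤-trans (2*[m/2]≤m (3 + p)) (≤-trans (m≤m+n (3 + p) p) (≤-reflexive (twice p))))
    where
    twice : ∀ p → 3 + p + p ≡ 2 * suc p + 1
    twice = solve-∀
  3h≤4+2p : 3 * h ≤ 4 + 2 * p
  3h≤4+2p = begin
    3 * h          ≡⟨ *-distribʳ-+ h 2 1 ⟩
    2 * h + 1 * h  ≡⟨ cong (2 * h +_) (*-identityˡ h) ⟩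
    2 * h + h      ≤⟨ +-mono-≤ (2*[m/2]≤m (3 + p)) h≤1+p ⟩
    3 + p + suc p  ≡⟨ cong (3 +_) (+-suc p p) ⟩
    4 + (p + p)    ≡⟨ cong (4 +_) (cong (p +_) (sym (+-identityʳ p))) ⟩
    4 + 2 * p      ∎
  expand : ∀ E r h → 3 * (E + suc r + h) ≡ 3 * E + 3 + 3 * r + 3 * h
  expand = solve-∀
  collect : ∀ E r p → 3 * E + 3 + 3 * r + (4 + 2 * p) + p * r ≡ (3 + p) * suc (suc r) + 3 * E + 1
  collect = solve-∀

theorem4 : (n m : ℕ) → 1 ≤ n → 3 ≤ m → BroadcastDomNumber m n (n + m / 2)
theorem4 n zero     _   ()
theorem4 n (suc m') 1≤n 3≤m = (hub , hub-dominating 1≤n , hub-cost) , optimal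
  where
  open Hub m' n
  optimal : ∀ f → Dominating m n f → n + m / 2 ≤ cost m n f
  optimal f dom rewrite cost≡∑ᵥ m n f with argmaxᵥ (λ x → f x ∸ depth x)
  ... | x , maximal with n ≤? f x ∸ depth x
  ...   | yes n≤E = from-leaves m n _ (Leaves.leaves-bound f 1≤n dom x n≤E)
  ...   | no  n≰E = subst (λ n → n + m / 2 ≤ ∑ᵥ f) (m+[n∸m]≡n (<⇒≤ E<n))
                      (from-levels E (n ∸ E) _ 3≤m (m<n⇒0<n∸m E<n)
                        (Levels.levels-bound f E E<n maximal dom x refl))
    where
    E = f x ∸ depth x
    E<n : E < n
    E<n = ≰⇒> n≰E
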